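{- Let $M$ be a model of $T$. Then any two distinct equivalence classes of edges of $M$ have at most one vertex in common.
   Context: Graphs are simple undirected graphs in the language $\{E\}$; subgraphs are induced. A vertex $x$ of a graph $A$ is removable from $A$ if it has at most one neighbour in $A$, or exactly two neighbours in $A$ which are adjacent. $T$ is the theory of graphs stating: (1) every edge is contained in exactly two triangles; (2) every finite subgraph has a removable vertex. The Farey graph $G_F$: $F_1$ is a black edge in two triangles whose other sides are blue; $F_{n+1}$ is obtained from $F_n$ by adding for each blue edge $e$ a new vertex joined to the endpoints of $e$ by two blue edges and recolouring the edges of $F_n$ black; $G_F=\bigcup_n F_n$ without colours. In a model $M$ of $T$, each edge $e$ generates a subgraph $F(e)$ of $M$ isomorphic to the Farey graph (the smallest subgraph containing $e$ which, for each of its edges, contains both triangles of $M$ on that edge). Two edges $e,e'$ of $M$ are equivalent if $F(e)=F(e')$ (equivalently, $e=e'$ or $e,e'$ lie on a common simple cycle). A vertex belongs to an equivalence class if it lies on one of the edges of that class. -}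

module Defs where

open import Data.Product using (Σ; ∃; _×_; _,_)
open import Data.Sum using (_⊎_)
open import Data.List using (List; _∷_; [])
open import Data.List.Membership.Propositional using (_∈_)
open import Relation.Nullary using (¬_)
open import Relation.Binary.PropositionalEquality using (_≡_)

record Graph : Set₁ where
  field
    V     : Set
    E     : V → V → Set
    E-sym : ∀ {x y} → E x y → E y x
    E-irr : ∀ {x} → ¬ E x x

module _ (G : Graph) where
  open Graph G

  -- Axiom (1): every edge lies in exactly two triangles, i.e. its endpoints
  -- have exactly two common neighbours.
  EdgeInTwoTriangles : Set
  EdgeInTwoTriangles =
    ∀ {u v} → E u v →
      Σ V λ c₁ → Σ V λ c₂ →
        ¬ (c₁ ≡ c₂) × (E u c₁ × E v c₁) × (E u c₂ × E v c₂) ×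
        (∀ c → E u c → E v c → (c ≡ c₁) ⊎ (c ≡ c₂))

  Removable : List V → V → Set
  Removable A x =
    (x ∈ A) ×
    ( (∀ y z → y ∈ A → z ∈ A → E x y → E x z → y ≡ z)
    ⊎ (Σ V λ y → Σ V λ z →
         y ∈ A × z ∈ A × ¬ (y ≡ z) × E x y × E x z × E y z ×
         (∀ w → w ∈ A → E x w → (w ≡ y) ⊎ (w ≡ z))) )

  -- Axiom (2): every (nonempty) finite induced subgraph has a removable vertex.
  FiniteHaveRemovable : Set
  FiniteHaveRemovable = ∀ (a : V) (A : List V) → ∃ λ x → Removable (a ∷ A) x

  ModelOfT : Set
  ModelOfT = EdgeInTwoTriangles × FiniteHaveRemovable

  Edge : Set
  Edge = Σ V λ u → Σ V λ v → E u v

  -- Vertex set of F(e): the smallest set containing the endpoints of e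
  -- which, with every edge ab in it, contains every common neighbour of a,b
  -- (i.e. both triangles on ab).  F(e) is the induced subgraph on it.
  data InF (e : Edge) : V → Set where
    endˡ : ∀ {u v p} → e ≡ (u , v , p) → InF e u
    endʳ : ∀ {u v p} → e ≡ (u , v , p) → InF e v
    tri  : ∀ {a b c} → InF e a → InF e b → E a b → E a c → E b c → InF e c

  EdgeEquiv : Edge → Edge → Set
  EdgeEquiv e e' = ∀ x → (InF e x → InF e' x) × (InF e' x → InF e x)

  InClass : Edge → V → Set
  InClass e x = Σ Edge λ { (u , v , p) →
                  EdgeEquiv e (u , v , p) × ((x ≡ u) ⊎ (x ≡ v)) }

-- Call a relation on edges triangle-closed if, with an edge ab, it contains
-- every edge of every triangle on ab; the class of an edge is such a
-- relation.  Take a closed walk consisting of a P-arc from x to y and a Q-arc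
-- back, and a removable vertex r of it: the two walk-neighbours of r
-- coincide or are adjacent.  If r is inside an arc, this shortens the arc;
-- if r is a junction of the arcs, it yields an edge lying in both P and Q.
-- Hence either x = y or P and Q share an edge.  Applied to a single edge ab
-- and a class-walk from b back to a, this shows that F(e) is connected by
-- edges of the class of e; applied to two classes sharing x and y, it gives
-- x = y.  Only axiom (2) is used.
module Submission where

open import Defs
open import Data.Empty using (⊥-elim)
open import Data.List using (List; []; _∷_; _++_)
open import Data.List.Membership.Propositional using (_∈_)
open import Data.List.Membership.Propositional.Properties using (∈-++⁺ˡ; ∈-++⁺ʳ; ∈-++⁻)
open import Data.List.Relation.Binary.Subset.Propositional using (_⊆_)
open import Data.List.Relation.Unary.Any using (here; there)
open import Data.Nat using (ℕ; zero; suc; _+_; _<_; s≤s)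
open import Data.Nat.Induction using (<-wellFounded)
open import Data.Nat.Properties using (≤-refl; n≤1+n; +-monoˡ-<; +-monoʳ-<)
open import Data.Product using (Σ-syntax; ∃; ∃₂; _×_; _,_; proj₁; proj₂)
open import Data.Sum using (_⊎_; inj₁; inj₂)
open import Induction.WellFounded using (Acc; acc)
open import Relation.Binary.Core using (_⇒_)
open import Relation.Binary.Definitions using (Symmetric)
open import Relation.Binary.Construct.Closure.ReflexiveTransitive using (Star; ε; _◅_; _◅◅_; reverse)
open import Relation.Binary.PropositionalEquality using (_≡_; refl)
open import Relation.Nullary using (¬_)

module _ (G : Graph) where
  open Graph G

  record IsTriangleClosed (P : V → V → Set) : Set where
    field
      ⊆E     : P ⇒ E
      sym    : Symmetric P
      closed : ∀ {a b c} → P a b → E a c → E b c → P a c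

  Overlap : (P Q : V → V → Set) → Set
  Overlap P Q = ∃₂ λ a b → P a b × Q a b

  -- The last vertex of the walk is not listed.
  vertices : ∀ {P : V → V → Set} {a b} → Star P a b → List V
  vertices ε               = []
  vertices {a = a} (_ ◅ W) = a ∷ vertices W

  steps : ∀ {P : V → V → Set} {a b} → Star P a b → ℕ
  steps ε       = zero
  steps (_ ◅ W) = suc (steps W)

  start∈ : ∀ {P a b L} (W : Star P a b) → vertices W ⊆ L → b ∈ L → a ∈ L
  start∈ ε       _  b∈ = b∈
  start∈ (_ ◅ _) W⊆ _  = W⊆ (here refl)

  lastStep : ∀ {P a b c} (p : P a b) (W : Star P b c) →
             ∃ λ z → P z c × z ∈ vertices (p ◅ W)
  lastStep p ε = _ , p , here refl
  lastStep _ (p ◅ W) with lastStep p W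
  ... | z , pzc , z∈ = z , pzc , there z∈

  NeighboursAdjacent : V → List V → Set
  NeighboursAdjacent r L =
    ∀ {s t} → s ∈ L → t ∈ L → E r s → E r t → (s ≡ t) ⊎ E s t

  removable⇒neighboursAdjacent : ∀ {L r} → Removable G L r → NeighboursAdjacent r L
  removable⇒neighboursAdjacent (_ , inj₁ unique) s∈ t∈ ers ert =
    inj₁ (unique _ _ s∈ t∈ ers ert)
  removable⇒neighboursAdjacent (_ , inj₂ (_ , _ , _ , _ , _ , _ , _ , eyz , onlyYZ))
                               {s} {t} s∈ t∈ ers ert
    with onlyYZ s s∈ ers | onlyYZ t t∈ ert
  ... | inj₁ refl | inj₁ refl = inj₁ refl
  ... | inj₁ refl | inj₂ refl = inj₂ eyz
  ... | inj₂ refl | inj₁ refl = inj₂ (E-sym eyz)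
  ... | inj₂ refl | inj₂ refl = inj₁ refl

  module _ {P : V → V → Set} (P-tc : IsTriangleClosed P) where
    open IsTriangleClosed P-tc

    shortcut : ∀ {L r a w y} → NeighboursAdjacent r L → a ∈ L →
               (paw : P a w) (W : Star P w y) → vertices W ⊆ L → y ∈ L →
               r ∈ vertices W → Σ[ W' ∈ Star P a y ] steps W' < steps (paw ◅ W)
    shortcut adj a∈ paw (pwt ◅ W) W⊆ y∈ (here refl)
      with adj a∈ (start∈ W (λ v∈ → W⊆ (there v∈)) y∈) (E-sym (⊆E paw)) (⊆E pwt)
    ... | inj₁ refl = W , s≤s (n≤1+n _)
    ... | inj₂ eat  = closed paw eat (⊆E pwt) ◅ W , ≤-refl
    shortcut adj a∈ paw (pwt ◅ W) W⊆ y∈ (there r∈)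
      with shortcut adj (W⊆ (here refl)) pwt W (λ v∈ → W⊆ (there v∈)) y∈ r∈
    ... | W' , shorter = paw ◅ W' , s≤s shorter

  module _ {P Q : V → V → Set} (P-tc : IsTriangleClosed P) (Q-tc : IsTriangleClosed Q) where
    private
      module P = IsTriangleClosed P-tc
      module Q = IsTriangleClosed Q-tc

    overlapAtCorner : ∀ {L x z w} → NeighboursAdjacent x L → z ∈ L → w ∈ L →
                      Q z x → P x w → Overlap P Q
    overlapAtCorner adj z∈ w∈ qzx pxw with adj z∈ w∈ (E-sym (Q.⊆E qzx)) (P.⊆E pxw)
    ... | inj₁ refl = _ , _ , pxw , Q.sym qzx
    ... | inj₂ ezw  = _ , _ , P.closed pxw (E-sym (Q.⊆E qzx)) (E-sym ezw) , Q.sym qzx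

    shrinkOrOverlap : ∀ {L r x y v} (W₁ : Star P x y) (q : Q y v) (W₂ : Star Q v x) →
                  vertices W₁ ⊆ L → vertices (q ◅ W₂) ⊆ L →
                  NeighboursAdjacent r L → r ∈ vertices W₁ →
                  Overlap P Q ⊎ (Σ[ W₁' ∈ Star P x y ] steps W₁' < steps W₁)
    shrinkOrOverlap (p ◅ W₁) q W₂ W₁⊆ W₂⊆ adj (here refl) with lastStep q W₂
    ... | z , qzx , z∈ =
      inj₁ (overlapAtCorner adj (W₂⊆ z∈)
              (start∈ W₁ (λ v∈ → W₁⊆ (there v∈)) (W₂⊆ (here refl))) qzx p)
    shrinkOrOverlap (p ◅ W₁) q W₂ W₁⊆ W₂⊆ adj (there r∈) =
      inj₂ (shortcut P-tc adj (W₁⊆ (here refl)) p W₁ (λ v∈ → W₁⊆ (there v∈))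
              (W₂⊆ (here refl)) r∈)

  overlap-swap : ∀ {P Q} → Overlap P Q → Overlap Q P
  overlap-swap (a , b , p , q) = a , b , q , p

  closedWalk⇒overlap : FiniteHaveRemovable G →
                       ∀ {P Q} → IsTriangleClosed P → IsTriangleClosed Q →
                       ∀ {x y} → Star P x y → Star Q y x → Overlap P Q ⊎ x ≡ y
  closedWalk⇒overlap removable {P} {Q} P-tc Q-tc W₁ W₂ = go W₁ W₂ (<-wellFounded _)
    where
    go : ∀ {x y} (W₁ : Star P x y) (W₂ : Star Q y x) →
         Acc _<_ (steps W₁ + steps W₂) → Overlap P Q ⊎ x ≡ y
    go ε _ _ = inj₂ refl
    go (_ ◅ _) ε _ = inj₂ refl
    go W₁@(p ◅ W₁') W₂@(q ◅ W₂') (acc smaller)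
      with removable _ (vertices W₁' ++ vertices W₂)
    ... | r , r∈ , r-removable with ∈-++⁻ (vertices W₁) r∈
    ...   | inj₁ r∈W₁ with shrinkOrOverlap P-tc Q-tc W₁ q W₂' ∈-++⁺ˡ (∈-++⁺ʳ (vertices W₁))
                             (removable⇒neighboursAdjacent (r∈ , r-removable)) r∈W₁
    ...     | inj₁ o = inj₁ o
    ...     | inj₂ (W₁'' , shorter) = go W₁'' W₂ (smaller (+-monoˡ-< (steps W₂) shorter))
    go W₁@(p ◅ W₁') W₂@(q ◅ W₂') (acc smaller)
        | r , r∈ , r-removable | inj₂ r∈W₂
      with shrinkOrOverlap Q-tc P-tc W₂ p W₁' (∈-++⁺ʳ (vertices W₁)) ∈-++⁺ˡ
             (removable⇒neighboursAdjacent (r∈ , r-removable)) r∈W₂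
    ...     | inj₁ o = inj₁ (overlap-swap o)
    ...     | inj₂ (W₂'' , shorter) = go W₁ W₂'' (smaller (+-monoʳ-< (steps W₁) shorter))

  EdgeEquiv-refl : ∀ {e} → EdgeEquiv G e e
  EdgeEquiv-refl _ = (λ z∈ → z∈) , (λ z∈ → z∈)

  EdgeEquiv-sym : ∀ {e e'} → EdgeEquiv G e e' → EdgeEquiv G e' e
  EdgeEquiv-sym e~e' z = proj₂ (e~e' z) , proj₁ (e~e' z)

  EdgeEquiv-trans : ∀ {e e' e''} → EdgeEquiv G e e' → EdgeEquiv G e' e'' →
                    EdgeEquiv G e e''
  EdgeEquiv-trans e~e' e'~e'' z =
    (λ z∈ → proj₁ (e'~e'' z) (proj₁ (e~e' z) z∈)) ,
    (λ z∈ → proj₂ (e~e' z) (proj₂ (e'~e'' z) z∈))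

  InF-⊆ : ∀ {e a b p z} → InF G e a → InF G e b → InF G (a , b , p) z → InF G e z
  InF-⊆ a∈ b∈ (endˡ refl)              = a∈
  InF-⊆ a∈ b∈ (endʳ refl)              = b∈
  InF-⊆ a∈ b∈ (tri c∈ d∈ ecd ece edf) = tri (InF-⊆ a∈ b∈ c∈) (InF-⊆ a∈ b∈ d∈) ecd ece edf

  EdgeEquiv-intro : ∀ {a b p c d q} →
                    InF G (c , d , q) a → InF G (c , d , q) b →
                    InF G (a , b , p) c → InF G (a , b , p) d →
                    EdgeEquiv G (a , b , p) (c , d , q)
  EdgeEquiv-intro a∈ b∈ c∈ d∈ _ = InF-⊆ a∈ b∈ , InF-⊆ c∈ d∈

  ClassEdge : Edge G → V → V → Set
  ClassEdge e a b = Σ[ p ∈ E a b ] EdgeEquiv G e (a , b , p)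

  ClassEdge-sym : ∀ {e} → Symmetric (ClassEdge e)
  ClassEdge-sym (p , e~ab) =
    E-sym p , EdgeEquiv-trans e~ab
                (EdgeEquiv-intro (endʳ refl) (endˡ refl) (endʳ refl) (endˡ refl))

  ClassEdge-triangle : ∀ {e a b c} → ClassEdge e a b → E a c → E b c → ClassEdge e a c
  ClassEdge-triangle (p , e~ab) eac ebc =
    eac , EdgeEquiv-trans e~ab
            (EdgeEquiv-intro (endˡ refl) (tri (endˡ refl) (endʳ refl) eac p (E-sym ebc))
                             (endˡ refl) (tri (endˡ refl) (endʳ refl) p eac ebc))

  ClassEdge-isTriangleClosed : ∀ {e} → IsTriangleClosed (ClassEdge e)
  ClassEdge-isTriangleClosed = record
    { ⊆E = proj₁ ; sym = ClassEdge-sym ; closed = ClassEdge-triangle }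

  overlap⇒EdgeEquiv : ∀ {e e'} → Overlap (ClassEdge e) (ClassEdge e') → EdgeEquiv G e e'
  overlap⇒EdgeEquiv (_ , _ , (_ , e~ab) , (_ , e'~ab)) =
    EdgeEquiv-trans e~ab
      (EdgeEquiv-trans (EdgeEquiv-intro (endˡ refl) (endʳ refl) (endˡ refl) (endʳ refl))
                       (EdgeEquiv-sym e'~ab))

  module _ (removable : FiniteHaveRemovable G) where

    closingEdge : ∀ {e a b} → Star (ClassEdge e) b a → (p : E a b) → ClassEdge e a b
    closingEdge W p
      with closedWalk⇒overlap removable ClassEdge-isTriangleClosed ClassEdge-isTriangleClosed
             ((p , EdgeEquiv-refl) ◅ ε) W
    ... | inj₁ o    = p , EdgeEquiv-sym (overlap⇒EdgeEquiv o)
    ... | inj₂ refl = ⊥-elim (E-irr p)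

    InF⇒walk : ∀ {e z} → InF G e z → Star (ClassEdge e) z (proj₁ e)
    InF⇒connected : ∀ {e a b} → InF G e a → InF G e b → Star (ClassEdge e) a b

    InF⇒walk (endˡ refl) = ε
    InF⇒walk {e = _ , _ , p} (endʳ refl) = ClassEdge-sym (p , EdgeEquiv-refl) ◅ ε
    InF⇒walk (tri a∈ b∈ eab eac ebc) =
      ClassEdge-sym (ClassEdge-triangle (closingEdge (InF⇒connected b∈ a∈) eab) eac ebc)
        ◅ InF⇒walk a∈

    InF⇒connected a∈ b∈ = InF⇒walk a∈ ◅◅ reverse ClassEdge-sym (InF⇒walk b∈)

  InClass⇒InF : ∀ {e x} → InClass G e x → InF G e x
  InClass⇒InF {x = x} (_ , e~f , inj₁ refl) = proj₂ (e~f x) (endˡ refl)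
  InClass⇒InF {x = x} (_ , e~f , inj₂ refl) = proj₂ (e~f x) (endʳ refl)

lemma2p20 : (G : Graph) → ModelOfT G →
    (e e' : Edge G) → ¬ EdgeEquiv G e e' →
    (x y : Graph.V G) →
    InClass G e x → InClass G e' x → InClass G e y → InClass G e' y →
    x ≡ y
lemma2p20 G (_ , removable) e e' e≁e' x y x∈e x∈e' y∈e y∈e'
  with closedWalk⇒overlap G removable
         (ClassEdge-isTriangleClosed G) (ClassEdge-isTriangleClosed G)
         (InF⇒connected G removable (InClass⇒InF G x∈e) (InClass⇒InF G y∈e))
         (InF⇒connected G removable (InClass⇒InF G y∈e') (InClass⇒InF G x∈e'))
... | inj₁ o   = ⊥-elim (e≁e' (overlap⇒EdgeEquiv G o))
... | inj₂ x≡y = x≡y
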